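{- Let $T$ be a tree of order $n$ with $\ell$ leaves. Then $$\sum_{\substack{u,v\in V(T)\\ \deg(u)>1,\ \deg(v)=1}} d(v,u)\le \ell\,\frac{(n-\ell)(n-\ell+1)}{2},$$ and $$\mathrm{TW}(T)\le \ell(\ell-1)+\left\lfloor\frac{\ell^2}{4}\right\rfloor(n-\ell-1).$$
   Context: $d(u,v)$ is the distance in $T$ and a leaf is a vertex of degree $1$. The first sum runs over pairs consisting of a non-leaf $u$ and a leaf $v$. The terminal Wiener index is $\mathrm{TW}(T)=\sum d(u,v)$, summed over all unordered pairs $\{u,v\}$ of distinct leaves of $T$. -}

module Defs where

open import Data.Nat using (ℕ; zero; suc; _+_; _≤_; _<_; _<ᵇ_; _≡ᵇ_)
open import Data.Bool using (Bool; true; false; if_then_else_; _∧_)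
open import Data.Fin using (Fin; toℕ)
open import Data.List using (List; []; _∷_; map; length; allFin)
open import Data.Nat.ListAction using (sum)
open import Data.List.Relation.Unary.Unique.Propositional using (Unique)
open import Data.List.Relation.Unary.Linked using (Linked)
open import Data.List.Relation.Unary.Any using (Any)
open import Data.Product using (Σ; _×_; ∃)
open import Relation.Binary.PropositionalEquality using (_≡_)
open import Relation.Nullary using (¬_)

record Graph (n : ℕ) : Set where
  field
    adj    : Fin n → Fin n → Bool
    sym    : ∀ u v → adj u v ≡ adj v u
    irrefl : ∀ v → adj v v ≡ false
open Graph public

Adj : ∀ {n} → Graph n → Fin n → Fin n → Set
Adj G u v = adj G u v ≡ true

data Walk {n : ℕ} (G : Graph n) : Fin n → Fin n → ℕ → Set where
  nil  : ∀ {u} → Walk G u u 0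
  cons : ∀ {u w v k} → Adj G u w → Walk G w v k → Walk G u v (suc k)

Connected : ∀ {n} → Graph n → Set
Connected G = ∀ u v → ∃ λ k → Walk G u v k

lastOf : ∀ {A : Set} → A → List A → A
lastOf x []       = x
lastOf x (y ∷ ys) = lastOf y ys

-- A cycle: distinct vertices v₀ … v_{k-1}, k ≥ 3, consecutive ones adjacent
-- and v_{k-1} adjacent to v₀.
IsCycle : ∀ {n} → Graph n → Fin n → List (Fin n) → Set
IsCycle G v₀ vs =
  (2 ≤ length vs) × Unique (v₀ ∷ vs) × Linked (Adj G) (v₀ ∷ vs) × Adj G (lastOf v₀ vs) v₀

Acyclic : ∀ {n} → Graph n → Set
Acyclic G = ∀ v₀ vs → ¬ IsCycle G v₀ vs

IsTree : ∀ {n} → Graph n → Set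
IsTree G = Connected G × Acyclic G

IsDistance : ∀ {n} → Graph n → (Fin n → Fin n → ℕ) → Set
IsDistance G d = ∀ u v → Walk G u v (d u v) × (∀ k → Walk G u v k → d u v ≤ k)

deg : ∀ {n} → Graph n → Fin n → ℕ
deg {n} G v = sum (map (λ w → if adj G v w then 1 else 0) (allFin n))

isLeaf : ∀ {n} → Graph n → Fin n → Bool
isLeaf G v = deg G v ≡ᵇ 1

isNonLeaf : ∀ {n} → Graph n → Fin n → Bool
isNonLeaf G v = 1 <ᵇ deg G v

leaves : ∀ {n} → Graph n → ℕ
leaves {n} G = sum (map (λ v → if isLeaf G v then 1 else 0) (allFin n))

nonleafLeafSum : ∀ {n} → Graph n → (Fin n → Fin n → ℕ) → ℕ
nonleafLeafSum {n} G d =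
  sum (map (λ u → sum (map (λ v →
    if isNonLeaf G u ∧ isLeaf G v then d v u else 0) (allFin n))) (allFin n))

terminalWiener : ∀ {n} → Graph n → (Fin n → Fin n → ℕ) → ℕ
terminalWiener {n} G d =
  sum (map (λ u → sum (map (λ v →
    if (toℕ u <ᵇ toℕ v) ∧ isLeaf G u ∧ isLeaf G v then d u v else 0) (allFin n))) (allFin n))

module Submission where

-- Both inequalities hold for every graph G on Fin n with a distance function
-- d.  All counting is done with finite sums
-- ∑ of 0/1 indicators over the vertex set.
--
-- Fix a leaf v.  On a shortest path from a vertex u to v, the
-- interior vertices are non-leaves strictly closer to v, so a non-leaf at
-- distance k from v has at least k - 1 non-leaves closer to v.  The rank
-- bound (rank-bound) then gives ∑_{u non-leaf} d(v,u) ≤ 1 + 2 + ⋯ + c for the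
-- c ≤ n - ℓ non-leaves; summing over the ℓ leaves v gives the claim.
--
-- If G has a non-leaf r, consider the shortest-path tree
-- towards r and let A x be the set of vertices on the tree path from x up to
-- r (r excluded).  Then d(u,v) ≤ |A u △ A v|, so by double counting
-- 2·TW ≤ ∑_w 2·a_w·b_w, where a_w and b_w = ℓ - a_w count the leaves whose
-- path does or does not contain w.  A leaf w lies only on its own path
-- (a_w ≤ 1), the root lies on none, and a_w·b_w ≤ ⌊ℓ²/4⌋ for the remaining
-- n - ℓ - 1 vertices.  If G has no non-leaf, all distances are at most 1.

open import Defs hiding (sym)
open import Data.Nat using (ℕ; _+_; _*_; _∸_; _≤_; _/_)
open import Data.Fin using (Fin)
open import Data.Product using (_×_)
open import Relation.Binary.PropositionalEquality using (_≡_)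
open import Data.Integer using (ℤ; +_) renaming (_≤_ to _≤ℤ_; _+_ to _+ℤ_; _*_ to _*ℤ_; _-_ to _-ℤ_)

open import Data.Nat using (zero; suc; _<_; _<ᵇ_; _≡ᵇ_; z≤n; s≤s; NonZero)
open import Data.Nat.Properties hiding (_≟_)
open import Data.Nat.DivMod using (m*n/n≡m; m/n*n≤m; /-monoˡ-≤)
open import Data.Nat.Tactic.RingSolver using (solve-∀)
import Data.Nat.ListAction as List
open import Data.Integer using (_⊖_; -1ℤ; +≤+)
import Data.Integer.Properties as ℤP
open import Data.Bool using (Bool; true; false; if_then_else_; _∧_; _∨_; not; _xor_)
import Data.Bool as Bool
open import Data.Bool.Properties using (∧-comm; ∧-idem; ∧-zeroʳ; ¬-not; xor-comm; T-≡)
open import Data.Fin using (zero; suc; toℕ)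
open import Data.Fin.Properties using (_≟_; any?)
open import Data.List using (tabulate; allFin)
open import Data.List.Properties using (map-tabulate)
open import Data.Product using (∃; _,_; proj₁; proj₂)
open import Data.Sum using (_⊎_; inj₁; inj₂; [_,_]′)
open import Data.Empty using (⊥-elim)
open import Function using (id; _∘_)
open import Function.Bundles using (Equivalence)
open import Relation.Nullary using (Dec; yes; no; ¬_; does; ofʸ; ofⁿ)
open import Relation.Binary.PropositionalEquality
  using (refl; sym; trans; cong; cong₂; subst; subst₂; _≢_; module ≡-Reasoning)
open import Algebra.Properties.Semiring.Sum +-*-semiring
  using (∑-distrib-+; ∑-comm; sum-cong-≗; sum-replicate-zero; *-distribˡ-sum; *-distribʳ-sum)
  renaming (sum to ∑)

ind : Bool → ℕ
ind b = if b then 1 else 0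

ind≤1 : ∀ b → ind b ≤ 1
ind≤1 false = z≤n
ind≤1 true  = ≤-refl

ind-∧ : ∀ a b → ind (a ∧ b) ≡ ind a * ind b
ind-∧ false b = refl
ind-∧ true  b = sym (+-identityʳ (ind b))

_==_ : ∀ {n} → Fin n → Fin n → Bool
x == y = does (x ≟ y)

if-ind : ∀ b x → (if b then x else 0) ≡ ind b * x
if-ind false x = refl
if-ind true  x = sym (+-identityʳ x)

<ᵇ-exclusive : ∀ a b → ind (a <ᵇ b) + ind (b <ᵇ a) ≤ 1
<ᵇ-exclusive a b with a <ᵇ b | <ᵇ-reflects-< a b | b <ᵇ a | <ᵇ-reflects-< b a
... | true  | ofʸ a<b | true  | ofʸ b<a = ⊥-elim (<-asym a<b b<a)
... | true  | _       | false | _       = ≤-refl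
... | false | _       | true  | _       = ≤-refl
... | false | _       | false | _       = z≤n

<ᵇ-true : ∀ {a b} → a < b → (a <ᵇ b) ≡ true
<ᵇ-true {a} {b} a<b with a <ᵇ b | <ᵇ-reflects-< a b
... | true  | _        = refl
... | false | ofⁿ a≮b = ⊥-elim (a≮b a<b)

<ᵇ-false : ∀ {a b} → ¬ a < b → (a <ᵇ b) ≡ false
<ᵇ-false {a} {b} a≮b with a <ᵇ b | <ᵇ-reflects-< a b
... | true  | ofʸ a<b = ⊥-elim (a≮b a<b)
... | false | _       = refl

<ᵇ-irrefl : ∀ a → (a <ᵇ a) ≡ false
<ᵇ-irrefl a = <ᵇ-false {a} {a} (<-irrefl refl)

<ᵇ-step : ∀ a k → ind (a <ᵇ k) ≤ ind (a <ᵇ suc k)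
<ᵇ-step a k with a <ᵇ k | <ᵇ-reflects-< a k
... | false | _       = z≤n
... | true  | ofʸ a<k rewrite <ᵇ-true (m<n⇒m<1+n a<k) = ≤-refl

ordered-pair : ∀ lt gt c x → ind lt + ind gt ≤ 1 →
               (if lt ∧ c then x else 0) + (if gt ∧ c then x else 0) ≤ (if c then x else 0)
ordered-pair true  true  c x (s≤s ())
ordered-pair true  false c x _ = ≤-reflexive (+-identityʳ _)
ordered-pair false true  c x _ = ≤-refl
ordered-pair false false c x _ = z≤n

-- For members lu, lv and memberships mu, mv of a set: (u,v) is a pair of
-- members exactly one of which lies in the set, in one of two orders.
separates : ∀ lu lv mu mv → ind (lu ∧ lv) * ind (mu xor mv) ≡
            ind (lu ∧ mu) * ind (lv ∧ not mv) + ind (lu ∧ not mu) * ind (lv ∧ mv)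
separates false lv    mu    mv    = refl
separates true  false true  mv    = refl
separates true  false false mv    = refl
separates true  true  true  true  = refl
separates true  true  true  false = refl
separates true  true  false true  = refl
separates true  true  false false = refl

∑-list : ∀ {n} (f : Fin n → ℕ) → List.sum (Data.List.map f (allFin n)) ≡ ∑ f
∑-list f = trans (cong List.sum (map-tabulate id f)) (sum-tabulate f)
  where
  sum-tabulate : ∀ {n} (f : Fin n → ℕ) → List.sum (tabulate f) ≡ ∑ f
  sum-tabulate {zero}  f = refl
  sum-tabulate {suc n} f = cong (_+_ (f zero)) (sum-tabulate (f ∘ suc))

∑₂-list : ∀ {n} (F : Fin n → Fin n → ℕ) →
          List.sum (Data.List.map (λ u → List.sum (Data.List.map (F u) (allFin n))) (allFin n)) ≡
          ∑ (λ u → ∑ (F u))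
∑₂-list {n} F = trans (∑-list (λ u → List.sum (Data.List.map (F u) (allFin n))))
                      (sum-cong-≗ λ u → ∑-list (F u))

∑-mono : ∀ {n} {f g : Fin n → ℕ} → (∀ x → f x ≤ g x) → ∑ f ≤ ∑ g
∑-mono {zero}  f≤g = z≤n
∑-mono {suc n} f≤g = +-mono-≤ (f≤g zero) (∑-mono (f≤g ∘ suc))

∑-ones : ∀ {n} → ∑ {n} (λ _ → 1) ≡ n
∑-ones {zero}  = refl
∑-ones {suc n} = cong suc (∑-ones {n})

∑-δ : ∀ {n} (u : Fin n) (g : Fin n → ℕ) → ∑ (λ x → ind (x == u) * g x) ≡ g u
∑-δ {suc n} zero g = begin
  (g zero + 0) + ∑ {n} (λ _ → 0) ≡⟨ cong₂ _+_ (+-identityʳ (g zero)) (sum-replicate-zero n) ⟩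
  g zero + 0                      ≡⟨ +-identityʳ (g zero) ⟩
  g zero                          ∎
  where open ≡-Reasoning
∑-δ {suc n} (suc u) g = ∑-δ {n} u (g ∘ suc)

∑-point : ∀ {n} (u : Fin n) → ∑ (λ x → ind (x == u)) ≡ 1
∑-point u = trans (sum-cong-≗ (λ x → sym (*-identityʳ (ind (x == u))))) (∑-δ u (λ _ → 1))

∑-product : ∀ {n} (f g : Fin n → ℕ) → ∑ (λ x → ∑ (λ y → f x * g y)) ≡ ∑ f * ∑ g
∑-product f g = begin
  ∑ (λ x → ∑ (λ y → f x * g y)) ≡⟨ sum-cong-≗ (λ x → sym (*-distribˡ-sum (f x) g)) ⟩
  ∑ (λ x → f x * ∑ g)           ≡⟨ sym (*-distribʳ-sum (∑ g) f) ⟩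
  ∑ f * ∑ g                     ∎
  where open ≡-Reasoning

count : ∀ {n} → (Fin n → Bool) → ℕ
count P = ∑ (ind ∘ P)

pairSum : ∀ {n} → (Fin n → Bool) → (Fin n → Fin n → ℕ) → ℕ
pairSum P h = ∑ λ u → ∑ λ v → ind (P u ∧ P v) * h u v

pairSum-+ : ∀ {n} (P : Fin n → Bool) (h k : Fin n → Fin n → ℕ) →
            pairSum P (λ u v → h u v + k u v) ≡ pairSum P h + pairSum P k
pairSum-+ P h k = trans (sum-cong-≗ λ u → trans
  (sum-cong-≗ λ v → *-distribˡ-+ (ind (P u ∧ P v)) (h u v) (k u v)) (∑-distrib-+ (weighted h u) (weighted k u)))
  (∑-distrib-+ (∑ ∘ weighted h) (∑ ∘ weighted k))
  where
  weighted : (Fin _ → Fin _ → ℕ) → Fin _ → Fin _ → ℕ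
  weighted g u v = ind (P u ∧ P v) * g u v

pairSum-mono : ∀ {n} (P : Fin n → Bool) {h k : Fin n → Fin n → ℕ} →
               (∀ u v → h u v ≤ k u v) → pairSum P h ≤ pairSum P k
pairSum-mono P h≤k = ∑-mono λ u → ∑-mono λ v → *-monoʳ-≤ (ind (P u ∧ P v)) (h≤k u v)

pairSum-flip : ∀ {n} (P : Fin n → Bool) (h : Fin n → Fin n → ℕ) →
               pairSum P h ≡ pairSum P (λ u v → h v u)
pairSum-flip P h = trans (∑-comm (λ u v → ind (P u ∧ P v) * h u v)) (sum-cong-≗ λ u → sum-cong-≗ λ v →
  cong (λ b → ind b * h v u) (∧-comm (P v) (P u)))

pairSum-all : ∀ {n} (P : Fin n → Bool) → pairSum P (λ _ _ → 1) ≡ count P * count P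
pairSum-all P = trans (sum-cong-≗ λ u → sum-cong-≗ λ v →
    trans (*-identityʳ (ind (P u ∧ P v))) (ind-∧ (P u) (P v)))
  (∑-product (ind ∘ P) (ind ∘ P))

pairSum-diagonal : ∀ {n} (P : Fin n → Bool) → pairSum P (λ u v → ind (v == u)) ≡ count P
pairSum-diagonal P = sum-cong-≗ λ u → begin
  ∑ (λ v → ind (P u ∧ P v) * ind (v == u)) ≡⟨ sum-cong-≗ (λ v → *-comm (ind (P u ∧ P v)) (ind (v == u))) ⟩
  ∑ (λ v → ind (v == u) * ind (P u ∧ P v)) ≡⟨ ∑-δ u (λ v → ind (P u ∧ P v)) ⟩
  ind (P u ∧ P u)                         ≡⟨ cong ind (∧-idem (P u)) ⟩
  ind (P u)                               ∎
  where open ≡-Reasoning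

pairSum-offDiagonal : ∀ {n} (P : Fin n → Bool) (h : Fin n → Fin n → ℕ) →
  (∀ u v → h u v + ind (v == u) ≤ 1) → pairSum P h + count P ≤ count P * count P
pairSum-offDiagonal P h h+δ≤1 = begin
  pairSum P h + count P                              ≡⟨ cong (_+_ (pairSum P h)) (sym (pairSum-diagonal P)) ⟩
  pairSum P h + pairSum P (λ u v → ind (v == u))     ≡⟨ sym (pairSum-+ P h _) ⟩
  pairSum P (λ u v → h u v + ind (v == u))           ≤⟨ pairSum-mono P h+δ≤1 ⟩
  pairSum P (λ _ _ → 1)                              ≡⟨ pairSum-all P ⟩
  count P * count P                                  ∎
  where open ≤-Reasoning

rank-bound : ∀ {n} (P : Fin n → Bool) (f : Fin n → ℕ) →
  (∀ u → P u ≡ true → f u ≤ suc (∑ λ v → ind (P v) * ind (f v <ᵇ f u))) →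
  let S = ∑ λ u → ind (P u) * f u in S + S ≤ count P * count P + count P
rank-bound {n} P f rank = begin
  S + S                 ≤⟨ +-mono-≤ S≤c+B S≤c+B ⟩
  (c + B) + (c + B)     ≡⟨ regroup c B ⟩
  (B + B + c) + c       ≤⟨ +-monoˡ-≤ c B+B+c≤c² ⟩
  c * c + c             ∎
  where
  open ≤-Reasoning
  c = count P
  S = ∑ λ u → ind (P u) * f u
  smaller : Fin n → Fin n → ℕ
  smaller u v = ind (f v <ᵇ f u)
  B = pairSum P smaller
  lighter : Fin n → ℕ
  lighter u = ∑ λ v → ind (P v) * smaller u v
  regroup : ∀ c B → (c + B) + (c + B) ≡ (B + B + c) + c
  regroup = solve-∀

  term≤ : ∀ u → ind (P u) * f u ≤ ind (P u) + ind (P u) * lighter u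
  term≤ u with P u in Pu
  ... | false = z≤n
  ... | true  = subst₂ _≤_ (sym (+-identityʳ (f u))) (cong suc (sym (+-identityʳ _))) (rank u Pu)

  S≤c+B : S ≤ c + B
  S≤c+B = begin
    S                                                          ≤⟨ ∑-mono term≤ ⟩
    ∑ (λ u → ind (P u) + ind (P u) * lighter u)                ≡⟨ ∑-distrib-+ (ind ∘ P) (λ u → ind (P u) * lighter u) ⟩
    c + ∑ (λ u → ind (P u) * lighter u)
      ≡⟨ cong (_+_ c) (sum-cong-≗ λ u → trans (*-distribˡ-sum (ind (P u)) (λ v → ind (P v) * smaller u v))
           (sum-cong-≗ λ v → trans (sym (*-assoc (ind (P u)) (ind (P v)) _))
             (cong (_* smaller u v) (sym (ind-∧ (P u) (P v)))))) ⟩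
    c + B                                                      ∎

  at-most-one : ∀ u v → (smaller u v + smaller v u) + ind (v == u) ≤ 1
  at-most-one u v with v ≟ u
  ... | yes refl rewrite <ᵇ-irrefl (f u) = ≤-refl
  ... | no  _    = subst (_≤ 1) (sym (+-identityʳ _)) (<ᵇ-exclusive (f v) (f u))

  B+B+c≤c² : B + B + c ≤ c * c
  B+B+c≤c² = begin
    B + B + c                                          ≡⟨ cong (λ B′ → B + B′ + c) (pairSum-flip P smaller) ⟩
    B + pairSum P (λ u v → smaller v u) + c            ≡⟨ cong (_+ c) (sym (pairSum-+ P smaller _)) ⟩
    pairSum P (λ u v → smaller u v + smaller v u) + c  ≤⟨ pairSum-offDiagonal P _ at-most-one ⟩
    c * c                                              ∎

≤-/ : ∀ a b k .{{_ : NonZero k}} → a * k ≤ b → a ≤ b / k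
≤-/ a b k ak≤b = subst (_≤ b / k) (m*n/n≡m a k) (/-monoˡ-≤ k ak≤b)

half-≤ : ∀ a b → a + a ≤ b → a ≤ b / 2
half-≤ a b 2a≤b = ≤-/ a b 2 (subst (_≤ b) (twice a) 2a≤b)
  where
  twice : ∀ a → a + a ≡ a * 2
  twice = solve-∀

double-cancel : ∀ a b → a + a ≤ b + b → a ≤ b
double-cancel a b = *-cancelˡ-≤ 2 ∘ subst₂ _≤_ (twice a) (twice b)
  where
  twice : ∀ x → x + x ≡ 2 * x
  twice x = cong (_+_ x) (sym (+-identityʳ x))

am-gm : ∀ a b → a * b * 4 ≤ (a + b) * (a + b)
am-gm a b = [ ordered , swapped ]′ (≤-total a b)
  where
  ordered : ∀ {a b} → a ≤ b → a * b * 4 ≤ (a + b) * (a + b)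
  ordered {a} {b} a≤b = subst (λ b → a * b * 4 ≤ (a + b) * (a + b)) (m+[n∸m]≡n a≤b)
    (subst (a * (a + (b ∸ a)) * 4 ≤_) (sym (gap a (b ∸ a))) (m≤m+n _ ((b ∸ a) * (b ∸ a))))
    where
    gap : ∀ a t → (a + (a + t)) * (a + (a + t)) ≡ a * (a + t) * 4 + t * t
    gap = solve-∀

  swapped : b ≤ a → a * b * 4 ≤ (a + b) * (a + b)
  swapped b≤a = subst₂ _≤_ (cong (_* 4) (*-comm b a)) (cong₂ _*_ (+-comm b a) (+-comm b a)) (ordered b≤a)

-- a·b ≤ ⌊(a + b)²/4⌋, the bound used for a vertex that is neither a leaf
-- nor the root.
product≤quarter : ∀ a b → a * b ≤ (a + b) * (a + b) / 4
product≤quarter a b = ≤-/ (a * b) _ 4 (am-gm a b)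

square-split : ∀ ℓ → ℓ * ℓ ≡ ℓ * (ℓ ∸ 1) + ℓ
square-split zero    = refl
square-split (suc k) = split k
  where
  split : ∀ k → suc k * suc k ≡ suc k * k + suc k
  split = solve-∀

-- 2⌊ℓ²/4⌋ ≤ ℓ(ℓ - 1): for ℓ ≥ 2 because 4⌊ℓ²/4⌋ ≤ ℓ² = ℓ(ℓ - 1) + ℓ ≤ 2ℓ(ℓ - 1).
twice-quarter : ∀ ℓ → ℓ * ℓ / 4 + ℓ * ℓ / 4 ≤ ℓ * (ℓ ∸ 1)
twice-quarter zero          = z≤n
twice-quarter (suc zero)    = z≤n
twice-quarter ℓ@(suc (suc k)) = double-cancel (q + q) Y (begin
  (q + q) + (q + q) ≡⟨ four q ⟩
  q * 4             ≤⟨ m/n*n≤m (ℓ * ℓ) 4 ⟩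
  ℓ * ℓ             ≡⟨ square-split ℓ ⟩
  Y + ℓ             ≤⟨ +-monoʳ-≤ Y (m≤m*n ℓ (suc k)) ⟩
  Y + Y             ∎)
  where
  open ≤-Reasoning
  q = ℓ * ℓ / 4
  Y = ℓ * (ℓ ∸ 1)
  four : ∀ q → (q + q) + (q + q) ≡ q * 4
  four = solve-∀

small-product : ∀ a b → a ≤ 1 → a * b ≤ (a + b) ∸ 1
small-product zero       b _ = z≤n
small-product (suc zero) b _ = ≤-reflexive (+-identityʳ b)
small-product (suc (suc a)) b (s≤s ())

rhs : (L q ℓ n : ℕ) → ℤ
rhs L q ℓ n = + L +ℤ (+ q) *ℤ (+ n -ℤ + ℓ -ℤ + 1)

rhs-shift : ∀ L q ℓ t → rhs L q ℓ (ℓ + t) ≡ + L +ℤ (+ q) *ℤ (+ t -ℤ + 1)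
rhs-shift L q ℓ t = cong (λ i → + L +ℤ (+ q) *ℤ (i -ℤ + 1)) (begin
  + (ℓ + t) -ℤ + ℓ  ≡⟨ ℤP.[+m]-[+n]≡m⊖n (ℓ + t) ℓ ⟩
  (ℓ + t) ⊖ ℓ       ≡⟨ ℤP.⊖-≥ (m≤m+n ℓ t) ⟩
  + (ℓ + t ∸ ℓ)     ≡⟨ cong +_ (m+n∸m≡n ℓ t) ⟩
  + t               ∎)
  where open ≡-Reasoning

rhs-above : ∀ L q ℓ K → rhs L q ℓ (ℓ + suc K) ≡ + (L + q * K)
rhs-above L q ℓ K = begin
  rhs L q ℓ (ℓ + suc K)              ≡⟨ rhs-shift L q ℓ (suc K) ⟩
  + L +ℤ (+ q) *ℤ (+ suc K -ℤ + 1)   ≡⟨ cong (λ i → + L +ℤ (+ q) *ℤ i) pred-suc ⟩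
  + L +ℤ (+ q) *ℤ (+ K)              ≡⟨ cong (_+ℤ_ (+ L)) (sym (ℤP.pos-* q K)) ⟩
  + (L + q * K)                      ∎
  where
  open ≡-Reasoning
  pred-suc : + suc K -ℤ + 1 ≡ + K
  pred-suc = trans (ℤP.[+m]-[+n]≡m⊖n (suc K) 1) (trans (ℤP.[1+m]⊖[1+n]≡m⊖n K 0) (ℤP.⊖-≥ z≤n))

rhs-at : ∀ L q ℓ → q ≤ L → rhs L q ℓ (ℓ + 0) ≡ + (L ∸ q)
rhs-at L q ℓ q≤L = begin
  rhs L q ℓ (ℓ + 0)              ≡⟨ rhs-shift L q ℓ 0 ⟩
  + L +ℤ (+ q) *ℤ -1ℤ            ≡⟨ cong (_+ℤ_ (+ L)) (trans (ℤP.*-comm (+ q) -1ℤ) (ℤP.-1*i≡-i (+ q))) ⟩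
  + L -ℤ + q                     ≡⟨ ℤP.[+m]-[+n]≡m⊖n L q ⟩
  L ⊖ q                          ≡⟨ ℤP.⊖-≥ q≤L ⟩
  + (L ∸ q)                      ∎
  where open ≡-Reasoning

rhs-lower : ∀ L q ℓ n → ℓ ≤ n → q ≤ L → + (L ∸ q) ≤ℤ rhs L q ℓ n
rhs-lower L q ℓ n ℓ≤n q≤L = subst (λ m → + (L ∸ q) ≤ℤ rhs L q ℓ m) (m+[n∸m]≡n ℓ≤n) (by-excess (n ∸ ℓ))
  where
  by-excess : ∀ t → + (L ∸ q) ≤ℤ rhs L q ℓ (ℓ + t)
  by-excess zero    = ℤP.≤-reflexive (sym (rhs-at L q ℓ q≤L))
  by-excess (suc K) = subst (+ (L ∸ q) ≤ℤ_) (sym (rhs-above L q ℓ K))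
                        (+≤+ (≤-trans (m∸n≤m L q) (m≤m+n L (q * K))))

adj-sym : ∀ {n} (G : Graph n) {u v} → Adj G u v → Adj G v u
adj-sym G {u} {v} uv = trans (Graph.sym G v u) uv

degree-∑ : ∀ {n} (G : Graph n) w → deg G w ≡ ∑ (λ x → ind (adj G w x))
degree-∑ G w = ∑-list (λ x → ind (adj G w x))

two-neighbours : ∀ {n} (G : Graph n) {w a b} → Adj G w a → Adj G w b → a ≢ b → 2 ≤ deg G w
two-neighbours G {w} {a} {b} wa wb a≢b = begin
  2                                        ≡⟨ cong₂ _+_ (∑-point a) (∑-point b) ⟨
  ∑ (λ x → ind (x == a)) + ∑ (λ x → ind (x == b)) ≡⟨ ∑-distrib-+ (λ x → ind (x == a)) (λ x → ind (x == b)) ⟨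
  ∑ (λ x → ind (x == a) + ind (x == b))    ≤⟨ ∑-mono one-of-two ⟩
  ∑ (λ x → ind (adj G w x))                ≡⟨ degree-∑ G w ⟨
  deg G w                                  ∎
  where
  open ≤-Reasoning
  one-of-two : ∀ x → ind (x == a) + ind (x == b) ≤ ind (adj G w x)
  one-of-two x with x ≟ a | x ≟ b
  ... | yes refl | yes refl = ⊥-elim (a≢b refl)
  ... | yes refl | no _     rewrite wa = ≤-refl
  ... | no _     | yes refl rewrite wb = ≤-refl
  ... | no _     | no _     = z≤n

nonleaf-of-degree : ∀ {n} (G : Graph n) {w} → 2 ≤ deg G w → isNonLeaf G w ≡ true
nonleaf-of-degree G 2≤deg = <ᵇ-true 2≤deg

leaf-degree : ∀ {n} (G : Graph n) {w} → isLeaf G w ≡ true → deg G w ≡ 1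
leaf-degree G {w} leaf = ≡ᵇ⇒≡ (deg G w) 1 (Equivalence.from T-≡ leaf)

leaf-or-nonleaf : ∀ {n} (G : Graph n) w → ind (isNonLeaf G w) + ind (isLeaf G w) ≤ 1
leaf-or-nonleaf G w = exclusive (deg G w)
  where
  exclusive : ∀ k → ind (1 <ᵇ k) + ind (k ≡ᵇ 1) ≤ 1
  exclusive zero          = z≤n
  exclusive (suc zero)    = ≤-refl
  exclusive (suc (suc k)) = ≤-refl

nonleaf-not-leaf : ∀ {n} (G : Graph n) {w} → isNonLeaf G w ≡ true → isLeaf G w ≡ false
nonleaf-not-leaf G {w} = excluded (deg G w)
  where
  excluded : ∀ k → (1 <ᵇ k) ≡ true → (k ≡ᵇ 1) ≡ false
  excluded zero          ()
  excluded (suc zero)    ()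
  excluded (suc (suc k)) _ = refl

leaf-count : ∀ {n} (G : Graph n) {ℓ} → leaves G ≡ ℓ → count (isLeaf G) ≡ ℓ
leaf-count G leaves≡ℓ = trans (sym (∑-list (ind ∘ isLeaf G))) leaves≡ℓ

nonleaves+leaves≤n : ∀ {n} (G : Graph n) {ℓ} → leaves G ≡ ℓ → count (isNonLeaf G) + ℓ ≤ n
nonleaves+leaves≤n {n} G {ℓ} leaves≡ℓ = begin
  count (isNonLeaf G) + ℓ                          ≡⟨ cong (_+_ (count (isNonLeaf G))) (leaf-count G leaves≡ℓ) ⟨
  count (isNonLeaf G) + count (isLeaf G)           ≡⟨ ∑-distrib-+ (ind ∘ isNonLeaf G) (ind ∘ isLeaf G) ⟨
  ∑ (λ w → ind (isNonLeaf G w) + ind (isLeaf G w)) ≤⟨ ∑-mono (leaf-or-nonleaf G) ⟩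
  ∑ {n} (λ _ → 1)                                  ≡⟨ ∑-ones ⟩
  n                                                ∎
  where open ≤-Reasoning

module Distance {n : ℕ} {G : Graph n} {d : Fin n → Fin n → ℕ} (isDist : IsDistance G d) where

  shortest : ∀ u v → Walk G u v (d u v)
  shortest u v = proj₁ (isDist u v)

  minimal : ∀ {u v k} → Walk G u v k → d u v ≤ k
  minimal {u} {v} = proj₂ (isDist u v) _

  snoc : ∀ {x y z k} → Walk G x y k → Adj G y z → Walk G x z (suc k)
  snoc nil         yz = cons yz nil
  snoc (cons xw W) yz = cons xw (snoc W yz)

  reverse : ∀ {x y k} → Walk G x y k → Walk G y x k
  reverse nil         = nil
  reverse (cons xw W) = snoc (reverse W) (adj-sym G xw)

  d-sym : ∀ u v → d u v ≡ d v u
  d-sym u v = ≤-antisym (minimal (reverse (shortest v u))) (minimal (reverse (shortest u v)))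

  d-self : ∀ u → d u u ≡ 0
  d-self u = n≤0⇒n≡0 (minimal nil)

  d-zero : ∀ {u v} → d u v ≡ 0 → u ≡ v
  d-zero {u} {v} e = empty (subst (Walk G u v) e (shortest u v))
    where
    empty : ∀ {x y} → Walk G x y 0 → x ≡ y
    empty nil = refl

  d-step : ∀ {u w} v → Adj G u w → d u v ≤ suc (d w v)
  d-step v uw = minimal (cons uw (shortest _ v))

  -- The shortest-path tree towards a root r: every vertex x ≠ r has a parent,
  -- a neighbour one step closer to r.
  module Rooted (r : Fin n) where

    depth : Fin n → ℕ
    depth x = d x r

    second : ∀ {x y k} → Walk G x y k → Fin n
    second {y = y} nil          = y
    second (cons {w = w} _ _)   = w

    parent : Fin n → Fin n
    parent x = second (shortest x r)

    parent-spec : ∀ x k → depth x ≡ suc k → Adj G x (parent x) × depth (parent x) ≡ k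
    parent-spec x k e = first-edge (shortest x r) e
      where
      first-edge : ∀ {m} (W : Walk G x r m) → m ≡ suc k → Adj G x (second W) × depth (second W) ≡ k
      first-edge (cons {w = w} xw W) refl =
        xw , ≤-antisym (minimal W) (≤-pred (subst (_≤ suc (depth w)) e (d-step r xw)))

    -- A vertex at depth ≥ 1 with a neighbour one level deeper has two
    -- distinct neighbours (that one and its parent), so it is a non-leaf.
    inner-degree : ∀ {w y} j → depth w ≡ suc j → Adj G w y → depth y ≡ suc (suc j) → 2 ≤ deg G w
    inner-degree {w} {y} j dw wy dy = two-neighbours G wy (proj₁ up) y≢parent
      where
      up = parent-spec w j dw
      y≢parent : y ≢ parent w
      y≢parent y≡p = <⇒≢ (m<n⇒m<1+n (n<1+n j)) (trans (sym (proj₂ up)) (trans (cong depth (sym y≡p)) dy))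

    closer : ℕ → ℕ
    closer k = ∑ λ u → ind (isNonLeaf G u) * ind (depth u <ᵇ k)

    -- The path from a vertex at depth k to r passes through k - 1 non-leaves
    -- at smaller depths.
    closer-nonleaves : ∀ k x → depth x ≡ k → k ∸ 1 ≤ closer k
    closer-nonleaves zero          x e = z≤n
    closer-nonleaves (suc zero)    x e = z≤n
    closer-nonleaves (suc (suc j)) x e = begin
      suc j                                   ≤⟨ s≤s (closer-nonleaves (suc j) w dw) ⟩
      suc (closer (suc j))                    ≡⟨ +-comm 1 (closer (suc j)) ⟩
      closer (suc j) + 1                      ≡⟨ cong (_+_ (closer (suc j))) (∑-point w) ⟨
      closer (suc j) + ∑ (λ u → ind (u == w)) ≡⟨ ∑-distrib-+ (below (suc j)) (λ u → ind (u == w)) ⟨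
      ∑ (λ u → below (suc j) u + ind (u == w)) ≤⟨ ∑-mono adds-w ⟩
      closer (suc (suc j))                    ∎
      where
      open ≤-Reasoning
      below : ℕ → Fin n → ℕ
      below k u = ind (isNonLeaf G u) * ind (depth u <ᵇ k)
      w = parent x
      up = parent-spec x (suc j) e
      dw : depth w ≡ suc j
      dw = proj₂ up
      w-nonleaf : isNonLeaf G w ≡ true
      w-nonleaf = nonleaf-of-degree G (inner-degree j dw (adj-sym G (proj₁ up)) e)
      adds-w : ∀ u → below (suc j) u + ind (u == w) ≤ below (suc (suc j)) u
      adds-w u with u ≟ w
      ... | yes refl rewrite w-nonleaf | dw | <ᵇ-irrefl j | <ᵇ-true (n<1+n j) = ≤-refl
      ... | no _     = subst (_≤ below (suc (suc j)) u) (sym (+-identityʳ _))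
                         (*-monoʳ-≤ (ind (isNonLeaf G u)) (<ᵇ-step (depth u) (suc j)))

    parent-below : ∀ x k → depth x ≡ suc k → depth (parent x) < depth x
    parent-below x k e = subst₂ _<_ (sym (proj₂ (parent-spec x k e))) (sym e) (n<1+n k)

    onPath : ℕ → Fin n → Fin n → Bool
    onPath zero    x w = false
    onPath (suc k) x w = (w == x) ∨ onPath k (parent x) w

    -- A x w: w lies on the tree path from x up to r (r excluded).
    A : Fin n → Fin n → Bool
    A x = onPath (depth x) x

    A-step : ∀ x k → depth x ≡ suc k → ∀ w → A x w ≡ (w == x) ∨ A (parent x) w
    A-step x k e w = trans (cong (λ m → onPath m x w) e)
      (cong (λ m → (w == x) ∨ onPath m (parent x) w) (sym (proj₂ (parent-spec x k e))))

    HasChild : Fin n → Set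
    HasChild w = ∃ λ y → Adj G w y × depth y ≡ suc (depth w)

    path-member : ∀ k x w → depth x ≡ k → onPath k x w ≡ true →
                  1 ≤ depth w × (w ≡ x ⊎ (HasChild w × depth w < depth x))
    path-member (suc k) x w e on with w ≟ x
    ... | yes refl = subst (1 ≤_) (sym e) (s≤s z≤n) , inj₁ refl
    ... | no _ with path-member k (parent x) w (proj₂ (parent-spec x k e)) on
    ...   | 1≤dw , inj₁ refl = 1≤dw , inj₂ (x-child , parent-below x k e)
      where
      x-child : HasChild (parent x)
      x-child = x , adj-sym G (proj₁ (parent-spec x k e)) , trans e (cong suc (sym (proj₂ (parent-spec x k e))))
    ...   | 1≤dw , inj₂ (child , above) = 1≤dw , inj₂ (child , <-trans above (parent-below x k e))

    root-off-path : ∀ x → A x r ≡ false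
    root-off-path x = ¬-not λ on → <⇒≢ (proj₁ (path-member _ x r refl on)) (sym (d-self r))

    off-path-deeper : ∀ x y → depth y ≤ depth x → x ≢ y → A y x ≡ false
    off-path-deeper x y y≤x x≢y = ¬-not λ on →
      [ x≢y , (λ (_ , above) → <-irrefl refl (<-≤-trans above y≤x)) ]′ (proj₂ (path-member _ y x refl on))

    -- A leaf lies on no path but its own: having a child and a parent it would
    -- have degree at least 2.
    leaf-on-path : ∀ w u → isLeaf G w ≡ true → A u w ≡ true → u ≡ w
    leaf-on-path w u leaf on with path-member _ u w refl on
    ... | _    , inj₁ w≡u = sym w≡u
    ... | 1≤dw , inj₂ ((y , wy , dy) , _) = ⊥-elim (<-irrefl (sym (leaf-degree G leaf)) deg≥2)
      where
      positive : ∀ {m} → 1 ≤ m → m ≡ suc (m ∸ 1)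
      positive (s≤s _) = refl
      deg≥2 : 2 ≤ deg G w
      deg≥2 = inner-degree (depth w ∸ 1) (positive 1≤dw) wy (trans dy (cong suc (positive 1≤dw)))

    -- X u v = |A u △ A v|, the length of the tree path from u to v.
    X : Fin n → Fin n → ℕ
    X u v = ∑ λ w → ind (A u w xor A v w)

    X-sym : ∀ u v → X u v ≡ X v u
    X-sym u v = sum-cong-≗ λ w → cong ind (xor-comm (A u w) (A v w))

    -- Replacing the deeper endpoint u by its parent removes u from A u △ A v.
    X-climb : ∀ u v k → depth u ≡ suc k → depth v ≤ depth u → u ≢ v → suc (X (parent u) v) ≤ X u v
    X-climb u v k e v≤u u≢v = begin
      suc (X (parent u) v)                          ≡⟨ cong (_+ X (parent u) v) (∑-point u) ⟨
      ∑ (λ w → ind (w == u)) + X (parent u) v      ≡⟨ ∑-distrib-+ (λ w → ind (w == u)) _ ⟨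
      ∑ (λ w → ind (w == u) + ind (A (parent u) w xor A v w)) ≤⟨ ∑-mono removes-u ⟩
      X u v                                         ∎
      where
      open ≤-Reasoning
      u≢parent : u ≢ parent u
      u≢parent eq = <-irrefl (cong depth (sym eq)) (parent-below u k e)
      removes-u : ∀ w → ind (w == u) + ind (A (parent u) w xor A v w) ≤ ind (A u w xor A v w)
      removes-u w rewrite A-step u k e w with w ≟ u
      ... | yes refl rewrite off-path-deeper u (parent u) (<⇒≤ (parent-below u k e)) u≢parent
                           | off-path-deeper u v v≤u u≢v = ≤-refl
      ... | no _     = ≤-refl

    deeper-nonroot : ∀ u v → depth v ≤ depth u → u ≢ v → ∃ λ k → depth u ≡ suc k
    deeper-nonroot u v v≤u u≢v with depth u in e
    ... | zero  = ⊥-elim (u≢v (trans (d-zero e) (sym (d-zero (n≤0⇒n≡0 v≤u)))))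
    ... | suc k = k , refl

    -- d(u,v) ≤ X u v, by induction on a bound s for the total depth of u and v:
    -- step from the deeper endpoint to its parent.
    mutual
      dist≤X : ∀ s u v → depth u + depth v ≤ s → d u v ≤ X u v
      dist≤X s u v bound with u ≟ v | ≤-total (depth v) (depth u)
      ... | yes refl | _        = subst (_≤ X u u) (sym (d-self u)) z≤n
      ... | no u≢v   | inj₁ v≤u = climb s u v v≤u u≢v bound
      ... | no u≢v   | inj₂ u≤v = subst₂ _≤_ (d-sym v u) (X-sym v u)
            (climb s v u u≤v (u≢v ∘ sym) (subst (_≤ s) (+-comm (depth u) (depth v)) bound))

      climb : ∀ s u v → depth v ≤ depth u → u ≢ v → depth u + depth v ≤ s → d u v ≤ X u v
      climb s u v v≤u u≢v bound with deeper-nonroot u v v≤u u≢v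
      climb zero    u v v≤u u≢v bound | k , e with subst (λ m → m + depth v ≤ 0) e bound
      ... | ()
      climb (suc s) u v v≤u u≢v bound | k , e = begin
        d u v                 ≤⟨ d-step v (proj₁ (parent-spec u k e)) ⟩
        suc (d (parent u) v)  ≤⟨ s≤s (dist≤X s (parent u) v parent-bound) ⟩
        suc (X (parent u) v)  ≤⟨ X-climb u v k e v≤u u≢v ⟩
        X u v                 ∎
        where
        open ≤-Reasoning
        parent-bound : depth (parent u) + depth v ≤ s
        parent-bound = subst (λ m → m + depth v ≤ s) (sym (proj₂ (parent-spec u k e)))
                             (≤-pred (subst (λ m → m + depth v ≤ suc s) e bound))

    d≤X : ∀ u v → d u v ≤ X u v
    d≤X u v = dist≤X (depth u + depth v) u v ≤-refl

  -- From any vertex v, a non-leaf at distance k has k - 1 non-leaves closer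
  -- to v, so by the rank bound the distances from v to the c non-leaves add
  -- up to at most 1 + 2 + ⋯ + c.
  nonleaf-distances : ∀ v → let S = ∑ (λ u → ind (isNonLeaf G u) * d v u) in
                      S + S ≤ count (isNonLeaf G) * count (isNonLeaf G) + count (isNonLeaf G)
  nonleaf-distances v =
    subst (λ S → S + S ≤ _) (sum-cong-≗ λ u → cong (_*_ (ind (isNonLeaf G u))) (d-sym u v))
      (rank-bound (isNonLeaf G) depth rank)
    where
    open Rooted v
    rank : ∀ u → isNonLeaf G u ≡ true → depth u ≤ suc (closer (depth u))
    rank u _ = ≤-trans (m≤n+m∸n (depth u) 1) (s≤s (closer-nonleaves (depth u) u refl))

  nonleaf-leaf-bound : ∀ ℓ → leaves G ≡ ℓ → nonleafLeafSum G d ≤ ℓ * ((n ∸ ℓ) * (n ∸ ℓ + 1) / 2)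
  nonleaf-leaf-bound ℓ leaves≡ℓ = begin
    nonleafLeafSum G d                          ≡⟨ ∑₂-list term ⟩
    ∑ (λ u → ∑ (λ v → term u v))               ≡⟨ ∑-comm term ⟩
    ∑ (λ v → ∑ (λ u → term u v))               ≡⟨ sum-cong-≗ per-leaf ⟩
    ∑ (λ v → ind (L v) * S v)                   ≤⟨ ∑-mono (λ v → *-monoʳ-≤ (ind (L v)) (S≤M v)) ⟩
    ∑ (λ v → ind (L v) * M)                     ≡⟨ *-distribʳ-sum M (ind ∘ L) ⟨
    count L * M                                 ≡⟨ cong (_* M) (leaf-count G leaves≡ℓ) ⟩
    ℓ * M                                       ∎
    where
    open ≤-Reasoning
    NL L : Fin n → Bool
    NL = isNonLeaf G
    L  = isLeaf G
    c = count NL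
    M = (n ∸ ℓ) * (n ∸ ℓ + 1) / 2
    term : Fin n → Fin n → ℕ
    term u v = if NL u ∧ L v then d v u else 0
    S : Fin n → ℕ
    S v = ∑ λ u → ind (NL u) * d v u

    regroup : ∀ a b x → a * b * x ≡ b * (a * x)
    regroup = solve-∀

    per-leaf : ∀ v → ∑ (λ u → term u v) ≡ ind (L v) * S v
    per-leaf v = trans (sum-cong-≗ λ u → trans (if-ind (NL u ∧ L v) (d v u))
                   (trans (cong (_* d v u) (ind-∧ (NL u) (L v))) (regroup (ind (NL u)) (ind (L v)) (d v u))))
                 (sym (*-distribˡ-sum (ind (L v)) (λ u → ind (NL u) * d v u)))

    c≤n∸ℓ : c ≤ n ∸ ℓ
    c≤n∸ℓ = m+n≤o⇒m≤o∸n c (nonleaves+leaves≤n G leaves≡ℓ)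

    S≤M : ∀ v → S v ≤ M
    S≤M v = ≤-trans (half-≤ (S v) (c * c + c) (nonleaf-distances v))
      (/-monoˡ-≤ 2 (subst (_≤ (n ∸ ℓ) * (n ∸ ℓ + 1)) (c*[c+1] c)
                     (*-mono-≤ c≤n∸ℓ (+-monoˡ-≤ 1 c≤n∸ℓ))))
      where
      c*[c+1] : ∀ c → c * (c + 1) ≡ c * c + c
      c*[c+1] = solve-∀

  terminal-pairs : terminalWiener G d + terminalWiener G d ≤ pairSum (isLeaf G) d
  terminal-pairs = begin
    terminalWiener G d + terminalWiener G d
      ≡⟨ cong₂ _+_ (∑₂-list wiener) (trans (∑₂-list wiener) (∑-comm wiener)) ⟩
    ∑ (λ u → ∑ (wiener u)) + ∑ (λ u → ∑ (λ v → wiener v u))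
      ≡⟨ ∑-distrib-+ (λ u → ∑ (wiener u)) (λ u → ∑ (λ v → wiener v u)) ⟨
    ∑ (λ u → ∑ (wiener u) + ∑ (λ v → wiener v u))
      ≡⟨ sum-cong-≗ (λ u → ∑-distrib-+ (wiener u) (λ v → wiener v u)) ⟨
    ∑ (λ u → ∑ (λ v → wiener u v + wiener v u))
      ≤⟨ ∑-mono (λ u → ∑-mono (λ v → both-orders u v)) ⟩
    ∑ (λ u → ∑ (λ v → if L u ∧ L v then d u v else 0))
      ≡⟨ sum-cong-≗ (λ u → sum-cong-≗ (λ v → if-ind (L u ∧ L v) (d u v))) ⟩
    pairSum L d ∎
    where
    open ≤-Reasoning
    L : Fin n → Bool
    L = isLeaf G
    wiener : Fin n → Fin n → ℕ
    wiener u v = if (toℕ u <ᵇ toℕ v) ∧ L u ∧ L v then d u v else 0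
    both-orders : ∀ u v → wiener u v + wiener v u ≤ (if L u ∧ L v then d u v else 0)
    both-orders u v = subst (λ t → wiener u v + t ≤ (if L u ∧ L v then d u v else 0))
      (sym (cong₂ (λ c x → if (toℕ v <ᵇ toℕ u) ∧ c then x else 0) (∧-comm (L v) (L u)) (d-sym v u)))
      (ordered-pair (toℕ u <ᵇ toℕ v) (toℕ v <ᵇ toℕ u) (L u ∧ L v) (d u v) (<ᵇ-exclusive (toℕ u) (toℕ v)))

  no-nonleaf-distance : (∀ u → isNonLeaf G u ≡ false) → ∀ u v → d u v ≤ 1
  no-nonleaf-distance none u v =
    m∸n≡0⇒m≤n (n≤0⇒n≡0 (subst (depth u ∸ 1 ≤_) nothing-closer (closer-nonleaves (depth u) u refl)))
    where
    open Rooted v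
    nothing-closer : closer (depth u) ≡ 0
    nothing-closer = trans (sum-cong-≗ λ w → cong (λ b → ind b * ind (depth w <ᵇ depth u)) (none w))
                           (sum-replicate-zero n)

  no-nonleaf-bound : (∀ u → isNonLeaf G u ≡ false) → ∀ ℓ → leaves G ≡ ℓ →
                     terminalWiener G d + ℓ * ℓ / 4 ≤ ℓ * (ℓ ∸ 1)
  no-nonleaf-bound none ℓ leaves≡ℓ = double-cancel (TW + q) Y (begin
    (TW + q) + (TW + q) ≡⟨ regroup TW q ⟩
    (TW + TW) + (q + q) ≤⟨ +-mono-≤ TW+TW≤Y (twice-quarter ℓ) ⟩
    Y + Y               ∎)
    where
    open ≤-Reasoning
    TW = terminalWiener G d
    q  = ℓ * ℓ / 4
    Y  = ℓ * (ℓ ∸ 1)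
    L  = isLeaf G
    regroup : ∀ a b → (a + b) + (a + b) ≡ (a + a) + (b + b)
    regroup = solve-∀
    count≡ℓ : count L ≡ ℓ
    count≡ℓ = leaf-count G leaves≡ℓ
    off-diagonal : ∀ u v → d u v + ind (v == u) ≤ 1
    off-diagonal u v with v ≟ u
    ... | yes refl rewrite d-self u = ≤-refl
    ... | no _     = subst (_≤ 1) (sym (+-identityʳ (d u v))) (no-nonleaf-distance none u v)
    TW+TW≤Y : TW + TW ≤ Y
    TW+TW≤Y = +-cancelʳ-≤ ℓ (TW + TW) Y (begin
      TW + TW + ℓ             ≤⟨ +-monoˡ-≤ ℓ terminal-pairs ⟩
      pairSum L d + ℓ         ≡⟨ cong (_+_ (pairSum L d)) count≡ℓ ⟨
      pairSum L d + count L   ≤⟨ pairSum-offDiagonal L d off-diagonal ⟩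
      count L * count L       ≡⟨ cong₂ _*_ count≡ℓ count≡ℓ ⟩
      ℓ * ℓ                   ≡⟨ square-split ℓ ⟩
      Y + ℓ                   ∎)

  -- The second bound when some non-leaf r exists, by double counting the
  -- vertices on the tree paths between pairs of leaves.
  module Tree (r : Fin n) (r-nonleaf : isNonLeaf G r ≡ true) (ℓ : ℕ) (leaves≡ℓ : leaves G ≡ ℓ) where
    open Rooted r

    L : Fin n → Bool
    L = isLeaf G

    count≡ℓ : count L ≡ ℓ
    count≡ℓ = leaf-count G leaves≡ℓ

    inside outside : Fin n → Fin n → ℕ
    inside  w u = ind (L u ∧ A u w)
    outside w u = ind (L u ∧ not (A u w))

    a b : Fin n → ℕ
    a w = ∑ (inside w)
    b w = ∑ (outside w)

    a+b≡ℓ : ∀ w → a w + b w ≡ ℓ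
    a+b≡ℓ w = trans (sym (∑-distrib-+ (inside w) (outside w)))
                    (trans (sum-cong-≗ λ u → split (L u) (A u w)) count≡ℓ)
      where
      split : ∀ l m → ind (l ∧ m) + ind (l ∧ not m) ≡ ind l
      split false m     = refl
      split true  true  = refl
      split true  false = refl

    -- Double counting: every vertex w contributes to the tree paths of the
    -- 2·a w·b w ordered pairs of leaves it separates.
    double-count : pairSum L X ≡ ∑ (λ w → a w * b w + b w * a w)
    double-count = begin
      pairSum L X                                 ≡⟨ sum-cong-≗ (λ u → sum-cong-≗ λ v →
                                                       *-distribˡ-sum (ind (L u ∧ L v)) (λ w → ind (A u w xor A v w))) ⟩
      ∑ (λ u → ∑ (λ v → ∑ (λ w → F u v w)))      ≡⟨ sum-cong-≗ (λ u → ∑-comm (F u)) ⟩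
      ∑ (λ u → ∑ (λ w → ∑ (λ v → F u v w)))      ≡⟨ ∑-comm (λ u w → ∑ (λ v → F u v w)) ⟩
      ∑ (λ w → ∑ (λ u → ∑ (λ v → F u v w)))      ≡⟨ sum-cong-≗ (λ w → sum-cong-≗ λ u → sum-cong-≗ λ v →
                                                       separates (L u) (L v) (A u w) (A v w)) ⟩
      ∑ (λ w → ∑ (λ u → ∑ (λ v → inside w u * outside w v + outside w u * inside w v)))
                                                  ≡⟨ sum-cong-≗ per-vertex ⟩
      ∑ (λ w → a w * b w + b w * a w)             ∎
      where
      open ≡-Reasoning
      F : Fin n → Fin n → Fin n → ℕ
      F u v w = ind (L u ∧ L v) * ind (A u w xor A v w)
      per-vertex : ∀ w → ∑ (λ u → ∑ (λ v → inside w u * outside w v + outside w u * inside w v))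
                         ≡ a w * b w + b w * a w
      per-vertex w = begin
        ∑ (λ u → ∑ (λ v → inside w u * outside w v + outside w u * inside w v))
          ≡⟨ sum-cong-≗ (λ u → ∑-distrib-+ (λ v → inside w u * outside w v) (λ v → outside w u * inside w v)) ⟩
        ∑ (λ u → ∑ (λ v → inside w u * outside w v) + ∑ (λ v → outside w u * inside w v))
          ≡⟨ ∑-distrib-+ (λ u → ∑ (λ v → inside w u * outside w v)) (λ u → ∑ (λ v → outside w u * inside w v)) ⟩
        ∑ (λ u → ∑ (λ v → inside w u * outside w v)) + ∑ (λ u → ∑ (λ v → outside w u * inside w v))
          ≡⟨ cong₂ _+_ (∑-product (inside w) (outside w)) (∑-product (outside w) (inside w)) ⟩
        a w * b w + b w * a w ∎

    internal : Fin n → Bool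
    internal w = not (L w) ∧ not (w == r)

    r-not-leaf : L r ≡ false
    r-not-leaf = nonleaf-not-leaf G r-nonleaf

    vertex-count : n ≡ ℓ + suc (count internal)
    vertex-count = begin
      n                                                      ≡⟨ ∑-ones ⟨
      ∑ {n} (λ _ → 1)                                        ≡⟨ sum-cong-≗ kind ⟨
      ∑ (λ w → ind (L w) + (ind (internal w) + ind (w == r)))
        ≡⟨ ∑-distrib-+ (ind ∘ L) (λ w → ind (internal w) + ind (w == r)) ⟩
      count L + ∑ (λ w → ind (internal w) + ind (w == r))
        ≡⟨ cong₂ _+_ count≡ℓ (∑-distrib-+ (ind ∘ internal) (λ w → ind (w == r))) ⟩
      ℓ + (count internal + ∑ (λ w → ind (w == r)))          ≡⟨ cong (λ m → ℓ + (count internal + m)) (∑-point r) ⟩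
      ℓ + (count internal + 1)                               ≡⟨ cong (_+_ ℓ) (+-comm (count internal) 1) ⟩
      ℓ + suc (count internal)                               ∎
      where
      open ≡-Reasoning
      kind : ∀ w → ind (L w) + (ind (internal w) + ind (w == r)) ≡ 1
      kind w with w ≟ r
      ... | yes refl rewrite r-not-leaf = refl
      ... | no _ with L w
      ...   | true  = refl
      ...   | false = refl

    -- Per-vertex bound on a w·b w: at most ℓ - 1 for a leaf (only its own
    -- path contains it), 0 for the root, ⌊ℓ²/4⌋ otherwise.
    cap : Fin n → ℕ
    cap w = ind (L w) * (ℓ ∸ 1) + ind (internal w) * (ℓ * ℓ / 4)

    a*b≤cap : ∀ w → a w * b w ≤ cap w
    a*b≤cap w with L w in leaf
    ... | true  = subst (a w * b w ≤_) (sym (trans (+-identityʳ _) (+-identityʳ _)))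
                    (subst (λ m → a w * b w ≤ m ∸ 1) (a+b≡ℓ w) (small-product (a w) (b w) a≤1))
      where
      only-itself : ∀ u → inside w u ≤ ind (u == w)
      only-itself u with u ≟ w
      ... | yes refl = ind≤1 _
      ... | no u≢w with A u w in on
      ...   | true  = ⊥-elim (u≢w (leaf-on-path w u leaf on))
      ...   | false = ≤-reflexive (cong ind (∧-zeroʳ (L u)))
      a≤1 : a w ≤ 1
      a≤1 = subst (a w ≤_) (∑-point w) (∑-mono only-itself)
    ... | false with w ≟ r
    ...   | yes refl = subst (λ m → m * b r ≤ 0) (sym a-root) z≤n
      where
      a-root : a r ≡ 0
      a-root = trans (sum-cong-≗ λ u → cong (λ m → ind (L u ∧ m)) (root-off-path u))
                     (trans (sum-cong-≗ λ u → cong ind (∧-zeroʳ (L u))) (sum-replicate-zero n))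
    ...   | no _     = subst (a w * b w ≤_) (sym (+-identityʳ _))
                         (subst (λ m → a w * b w ≤ m * m / 4) (a+b≡ℓ w) (product≤quarter (a w) (b w)))

    ∑-cap : ∑ cap ≡ ℓ * (ℓ ∸ 1) + ℓ * ℓ / 4 * count internal
    ∑-cap = begin
      ∑ cap
        ≡⟨ ∑-distrib-+ (λ w → ind (L w) * (ℓ ∸ 1)) (λ w → ind (internal w) * (ℓ * ℓ / 4)) ⟩
      ∑ (λ w → ind (L w) * (ℓ ∸ 1)) + ∑ (λ w → ind (internal w) * (ℓ * ℓ / 4))
        ≡⟨ cong₂ _+_ (*-distribʳ-sum (ℓ ∸ 1) (ind ∘ L)) (*-distribʳ-sum (ℓ * ℓ / 4) (ind ∘ internal)) ⟨
      count L * (ℓ ∸ 1) + count internal * (ℓ * ℓ / 4)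
        ≡⟨ cong₂ _+_ (cong (_* (ℓ ∸ 1)) count≡ℓ) (*-comm (count internal) (ℓ * ℓ / 4)) ⟩
      ℓ * (ℓ ∸ 1) + ℓ * ℓ / 4 * count internal
        ∎
      where open ≡-Reasoning

    tree-bound : terminalWiener G d ≤ ℓ * (ℓ ∸ 1) + ℓ * ℓ / 4 * count internal
    tree-bound = subst (TW ≤_) ∑-cap (double-cancel TW (∑ cap) (begin
      TW + TW                            ≤⟨ terminal-pairs ⟩
      pairSum L d                        ≤⟨ pairSum-mono L d≤X ⟩
      pairSum L X                        ≡⟨ double-count ⟩
      ∑ (λ w → a w * b w + b w * a w)    ≤⟨ ∑-mono (λ w → +-mono-≤ (a*b≤cap w) (b*a≤cap w)) ⟩
      ∑ (λ w → cap w + cap w)            ≡⟨ ∑-distrib-+ cap cap ⟩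
      ∑ cap + ∑ cap                      ∎))
      where
      open ≤-Reasoning
      TW = terminalWiener G d
      b*a≤cap : ∀ w → b w * a w ≤ cap w
      b*a≤cap w = subst (_≤ cap w) (*-comm (a w) (b w)) (a*b≤cap w)

  terminal-bound : ∀ ℓ → leaves G ≡ ℓ → + terminalWiener G d ≤ℤ rhs (ℓ * (ℓ ∸ 1)) (ℓ * ℓ / 4) ℓ n
  terminal-bound ℓ leaves≡ℓ = by-root (any? (λ u → isNonLeaf G u Bool.≟ true))
    where
    TW = terminalWiener G d
    Y  = ℓ * (ℓ ∸ 1)
    q  = ℓ * ℓ / 4
    by-root : Dec (∃ λ r → isNonLeaf G r ≡ true) → + TW ≤ℤ rhs Y q ℓ n
    by-root (yes (r , r-nonleaf)) = let open Tree r r-nonleaf ℓ leaves≡ℓ in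
      subst (λ m → + TW ≤ℤ rhs Y q ℓ m) (sym vertex-count)
        (subst (+ TW ≤ℤ_) (sym (rhs-above Y q ℓ (count internal))) (+≤+ tree-bound))
    by-root (no no-nonleaf) =
      ℤP.≤-trans (+≤+ (m+n≤o⇒m≤o∸n TW bound)) (rhs-lower Y q ℓ n ℓ≤n (m+n≤o⇒n≤o TW bound))
      where
      bound : TW + q ≤ Y
      bound = no-nonleaf-bound (λ u → ¬-not λ nonleaf → no-nonleaf (u , nonleaf)) ℓ leaves≡ℓ
      ℓ≤n : ℓ ≤ n
      ℓ≤n = m+n≤o⇒n≤o (count (isNonLeaf G)) (nonleaves+leaves≤n G leaves≡ℓ)

lemma11 : (n ℓ : ℕ) (G : Graph n) (d : Fin n → Fin n → ℕ) →
          IsTree G → IsDistance G d → leaves G ≡ ℓ →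
          (nonleafLeafSum G d ≤ ℓ * ((n ∸ ℓ) * (n ∸ ℓ + 1) / 2))
          × (+ terminalWiener G d ≤ℤ
               (+ (ℓ * (ℓ ∸ 1)) +ℤ (+ (ℓ * ℓ / 4)) *ℤ (+ n -ℤ + ℓ -ℤ + 1)))
lemma11 n ℓ G d _ isDist leaves≡ℓ = nonleaf-leaf-bound ℓ leaves≡ℓ , terminal-bound ℓ leaves≡ℓ
  where open Distance isDist
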